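{- For every cubic bridgeless graph $G$ and every integer $k\ge 4$, $m_{k-1}(G)\ge \tfrac{k-1}{k}\, m_k(G)+\tfrac{1}{3k}$.
   Context: A cubic bridgeless graph is a graph in which every vertex has degree 3 and each connected component is 2-edge-connected. A perfect matching of $G$ is a set of edges such that every vertex is incident to exactly one of them. For a cubic bridgeless graph $G$ and a positive integer $t$, $m_t(G)$ denotes the maximum, over all choices of $t$ perfect matchings $M_1,\dots,M_t$ of $G$, of $|M_1\cup\dots\cup M_t|/|E(G)|$. -}

module Defs where

open import Data.Nat using (ℕ; zero; suc; _+_)
open import Data.Bool using (Bool; true; false; _∧_; _∨_; if_then_else_)
open import Data.Fin using (Fin; zero; suc; _≟_)
open import Relation.Nullary.Decidable using (⌊_⌋)
open import Relation.Binary.PropositionalEquality using (_≡_; _≢_)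

-- Finite loopless multigraph: vertices Fin n, edges Fin m, each edge e joins
-- src e and tgt e (distinct).  Parallel edges are allowed.
record Multigraph : Set where
  field
    n        : ℕ
    m        : ℕ
    src      : Fin m → Fin n
    tgt      : Fin m → Fin n
    loopless : ∀ e → src e ≢ tgt e

open Multigraph public

count : ∀ {k} → (Fin k → Bool) → ℕ
count {zero}  p = 0
count {suc k} p = (if p zero then 1 else 0) + count (λ i → p (suc i))

anyFin : ∀ {k} → (Fin k → Bool) → Bool
anyFin {zero}  p = false
anyFin {suc k} p = p zero ∨ anyFin (λ i → p (suc i))

incident : (G : Multigraph) → Fin (m G) → Fin (n G) → Bool
incident G e v = ⌊ src G e ≟ v ⌋ ∨ ⌊ tgt G e ≟ v ⌋

degree : (G : Multigraph) → Fin (n G) → ℕ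
degree G v = count (λ e → incident G e v)

Cubic : Multigraph → Set
Cubic G = ∀ v → degree G v ≡ 3

data Conn (G : Multigraph) (e : Fin (m G)) : Fin (n G) → Fin (n G) → Set where
  here : ∀ {x} → Conn G e x x
  fwd  : ∀ f {z} → f ≢ e → Conn G e (tgt G f) z → Conn G e (src G f) z
  bwd  : ∀ f {z} → f ≢ e → Conn G e (src G f) z → Conn G e (tgt G f) z

-- e is a bridge iff its endpoints are disconnected in G - e; so:
-- every component 2-edge-connected  ⇔  no bridge
Bridgeless : Multigraph → Set
Bridgeless G = ∀ e → Conn G e (src G e) (tgt G e)

EdgeSet : Multigraph → Set
EdgeSet G = Fin (m G) → Bool

PerfectMatching : (G : Multigraph) → EdgeSet G → Set
PerfectMatching G M = ∀ v → count (λ e → M e ∧ incident G e v) ≡ 1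

unionSize : (G : Multigraph) {t : ℕ} → (Fin t → EdgeSet G) → ℕ
unionSize G Ms = count (λ e → anyFin (λ i → Ms i e))

module Submission where

-- Let U be the union of k ≥ 4 perfect matchings and call an edge of U private
-- if it lies in exactly one of them.  Deleting the matching with the fewest
-- private edges loses at most a 1/k fraction of the private edges.  The other
-- edges of U lie in at least two matchings; at every vertex the k matchings
-- give k ≥ 4 incidences on only three edges, so some edge there is repeated.
-- By double counting there are at least m/3 repeated edges, and the claimed
-- bound is the resulting linear inequality.

open import Defs
open import Data.Nat using (ℕ; suc; _+_; _*_; _≤_)
open import Data.Fin using (Fin)
open import Data.Product using (Σ; _×_)

open import Data.Nat using (zero; z≤n; s≤s; _<_)
open import Data.Nat.Properties hiding (_≟_)
open import Data.Nat.Tactic.RingSolver using (solve)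
open import Data.List using ([]; _∷_)
open import Data.Fin using (zero; suc; punchIn; _≟_)
open import Data.Vec.Functional using (removeAt)
open import Data.Bool using (Bool; true; false; _∧_)
open import Data.Product using (∃; _,_)
open import Data.Empty using (⊥-elim)
open import Function using (_∘_)
open import Relation.Nullary using (yes; no)
open import Relation.Nullary.Decidable using (⌊_⌋)
open import Relation.Binary.PropositionalEquality
open import Algebra.Properties.Semiring.Sum +-*-semiring
  using (sum; sum-syntax; sum-replicate-zero; sum-cong-≗; sum-remove; ∑-distrib-+; ∑-comm; *-distribˡ-sum; *-distribʳ-sum)

∑-const : ∀ n x → ∑[ _ < n ] x ≡ n * x
∑-const zero    x = refl
∑-const (suc n) x = cong (x +_) (∑-const n x)

sum-mono-≤ : ∀ {n} {f g : Fin n → ℕ} → (∀ i → f i ≤ g i) → sum f ≤ sum g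
sum-mono-≤ {zero}  f≤g = z≤n
sum-mono-≤ {suc n} f≤g = +-mono-≤ (f≤g zero) (sum-mono-≤ (f≤g ∘ suc))

sum≡0⇒≡0 : ∀ {n} (f : Fin n → ℕ) → sum f ≡ 0 → ∀ i → f i ≡ 0
sum≡0⇒≡0 f eq zero    = m+n≡0⇒m≡0 (f zero) eq
sum≡0⇒≡0 f eq (suc i) = sum≡0⇒≡0 (f ∘ suc) (m+n≡0⇒n≡0 (f zero) eq) i

∃-below-average : ∀ {n} (f : Fin (suc n) → ℕ) → ∃ λ i → suc n * f i ≤ sum f
∃-below-average {zero}  f = zero , ≤-refl
∃-below-average {suc n} f with ∃-below-average (f ∘ suc)
... | i , below with f zero ≤? f (suc i)
...   | yes f₀≤ = zero , +-monoʳ-≤ (f zero) (≤-trans (*-monoʳ-≤ (suc n) f₀≤) below)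
...   | no  f₀≰ = suc i , +-mono-≤ (≰⇒≥ f₀≰) below

iverson : Bool → ℕ
iverson false = 0
iverson true  = 1

iverson≤1 : ∀ b → iverson b ≤ 1
iverson≤1 false = z≤n
iverson≤1 true  = ≤-refl

iverson-∧ : ∀ x y → iverson (x ∧ y) ≡ iverson x * iverson y
iverson-∧ false y = refl
iverson-∧ true  y = sym (+-identityʳ (iverson y))

count≡∑iverson : ∀ {k} (p : Fin k → Bool) → count p ≡ ∑[ i < k ] iverson (p i)
count≡∑iverson {zero}  p = refl
count≡∑iverson {suc k} p with p zero
... | true  = cong suc (count≡∑iverson (p ∘ suc))
... | false = count≡∑iverson (p ∘ suc)

∑-iverson-≟ : ∀ {n} (x : Fin n) → ∑[ v < n ] iverson ⌊ x ≟ v ⌋ ≡ 1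
∑-iverson-≟ {suc n} zero    = cong suc (sum-replicate-zero n)
∑-iverson-≟ {suc n} (suc x) = trans (sum-cong-≗ suc-≟) (∑-iverson-≟ x)
  where
  suc-≟ : ∀ v → iverson ⌊ suc x ≟ suc v ⌋ ≡ iverson ⌊ x ≟ v ⌋
  suc-≟ v with x ≟ v
  ... | yes _ = refl
  ... | no  _ = refl

atLeastOnce exactlyOnce atLeastTwice : ℕ → ℕ
atLeastOnce zero    = 0
atLeastOnce (suc _) = 1

exactlyOnce 1 = 1
exactlyOnce _ = 0

atLeastTwice (suc (suc _)) = 1
atLeastTwice _             = 0

atLeastOnce≡exactlyOnce+atLeastTwice : ∀ c → atLeastOnce c ≡ exactlyOnce c + atLeastTwice c
atLeastOnce≡exactlyOnce+atLeastTwice zero          = refl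
atLeastOnce≡exactlyOnce+atLeastTwice (suc zero)    = refl
atLeastOnce≡exactlyOnce+atLeastTwice (suc (suc c)) = refl

*-exactlyOnce : ∀ c → c * exactlyOnce c ≡ exactlyOnce c
*-exactlyOnce zero          = refl
*-exactlyOnce (suc zero)    = refl
*-exactlyOnce (suc (suc c)) = *-zeroʳ (suc (suc c))

atLeastOnce-+-≤ : ∀ x c → x ≤ 1 → atLeastOnce (x + c) ≤ atLeastOnce c + x * exactlyOnce (x + c)
atLeastOnce-+-≤ zero          c       _ = m≤m+n (atLeastOnce c) 0
atLeastOnce-+-≤ (suc zero)    zero    _ = ≤-refl
atLeastOnce-+-≤ (suc zero)    (suc c) _ = s≤s z≤n
atLeastOnce-+-≤ (suc (suc x)) c       (s≤s ())

atLeastTwice*≡0⇒*≤ : ∀ x c → atLeastTwice c * x ≡ 0 → x * c ≤ x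
atLeastTwice*≡0⇒*≤ zero    c             _ = z≤n
atLeastTwice*≡0⇒*≤ (suc x) zero          _ = subst (_≤ suc x) (sym (*-zeroʳ (suc x))) z≤n
atLeastTwice*≡0⇒*≤ (suc x) (suc zero)    _ = ≤-reflexive (*-identityʳ (suc x))
atLeastTwice*≡0⇒*≤ (suc x) (suc (suc c)) ()

iverson-anyFin : ∀ {k} (p : Fin k → Bool) → iverson (anyFin p) ≡ atLeastOnce (∑[ i < k ] iverson (p i))
iverson-anyFin {zero}  p = refl
iverson-anyFin {suc k} p with p zero
... | true  = refl
... | false = iverson-anyFin (p ∘ suc)

multiplicity : ∀ {t} {A : Set} → (Fin t → A → Bool) → A → ℕ
multiplicity {t} Ms e = ∑[ l < t ] iverson (Ms l e)

multiplicity-removeAt : ∀ {t} {A : Set} (Ms : Fin (suc t) → A → Bool) (i : Fin (suc t)) e →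
  multiplicity Ms e ≡ iverson (Ms i e) + multiplicity (removeAt Ms i) e
multiplicity-removeAt Ms i e = sum-remove (λ l → iverson (Ms l e))

module _ (G : Multigraph) {t : ℕ} (Ms : Fin t → EdgeSet G) where

  privateEdges : Fin t → ℕ
  privateEdges l = ∑[ e < m G ] (iverson (Ms l e) * exactlyOnce (multiplicity Ms e))

  repeatedEdges : ℕ
  repeatedEdges = ∑[ e < m G ] atLeastTwice (multiplicity Ms e)

  unionSize≡∑atLeastOnce : unionSize G Ms ≡ ∑[ e < m G ] atLeastOnce (multiplicity Ms e)
  unionSize≡∑atLeastOnce =
    trans (count≡∑iverson (λ e → anyFin (λ l → Ms l e))) (sum-cong-≗ (λ e → iverson-anyFin (λ l → Ms l e)))

  ∑-privateEdges : ∑[ l < t ] privateEdges l ≡ ∑[ e < m G ] exactlyOnce (multiplicity Ms e)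
  ∑-privateEdges = begin
    ∑[ l < t ] ∑[ e < m G ] (iverson (Ms l e) * exactlyOnce (multiplicity Ms e))
      ≡⟨ ∑-comm (λ l e → iverson (Ms l e) * exactlyOnce (multiplicity Ms e)) ⟩
    ∑[ e < m G ] ∑[ l < t ] (iverson (Ms l e) * exactlyOnce (multiplicity Ms e))
      ≡⟨ sum-cong-≗ (λ e → *-distribʳ-sum (exactlyOnce (multiplicity Ms e)) (λ l → iverson (Ms l e))) ⟨
    ∑[ e < m G ] (multiplicity Ms e * exactlyOnce (multiplicity Ms e))
      ≡⟨ sum-cong-≗ (*-exactlyOnce ∘ multiplicity Ms) ⟩
    ∑[ e < m G ] exactlyOnce (multiplicity Ms e) ∎
    where open ≡-Reasoning

  unionSize≡private+repeated : unionSize G Ms ≡ ∑[ l < t ] privateEdges l + repeatedEdges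
  unionSize≡private+repeated = begin
    unionSize G Ms
      ≡⟨ unionSize≡∑atLeastOnce ⟩
    ∑[ e < m G ] atLeastOnce (multiplicity Ms e)
      ≡⟨ sum-cong-≗ (atLeastOnce≡exactlyOnce+atLeastTwice ∘ multiplicity Ms) ⟩
    ∑[ e < m G ] (exactlyOnce (multiplicity Ms e) + atLeastTwice (multiplicity Ms e))
      ≡⟨ ∑-distrib-+ (exactlyOnce ∘ multiplicity Ms) (atLeastTwice ∘ multiplicity Ms) ⟩
    ∑[ e < m G ] exactlyOnce (multiplicity Ms e) + repeatedEdges
      ≡⟨ cong (_+ repeatedEdges) ∑-privateEdges ⟨
    ∑[ l < t ] privateEdges l + repeatedEdges ∎
    where open ≡-Reasoning

unionSize-removeAt : (G : Multigraph) {t : ℕ} (Ms : Fin (suc t) → EdgeSet G) (i : Fin (suc t)) →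
  unionSize G Ms ≤ unionSize G (removeAt Ms i) + privateEdges G Ms i
unionSize-removeAt G Ms i = begin
  unionSize G Ms
    ≡⟨ unionSize≡∑atLeastOnce G Ms ⟩
  ∑[ e < m G ] atLeastOnce (multiplicity Ms e)
    ≡⟨ sum-cong-≗ (cong atLeastOnce ∘ multiplicity-removeAt Ms i) ⟩
  ∑[ e < m G ] atLeastOnce (xᵢ e + c e)
    ≤⟨ sum-mono-≤ (λ e → atLeastOnce-+-≤ (xᵢ e) (c e) (iverson≤1 (Ms i e))) ⟩
  ∑[ e < m G ] (atLeastOnce (c e) + xᵢ e * exactlyOnce (xᵢ e + c e))
    ≡⟨ ∑-distrib-+ (atLeastOnce ∘ c) (λ e → xᵢ e * exactlyOnce (xᵢ e + c e)) ⟩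
  ∑[ e < m G ] atLeastOnce (c e) + ∑[ e < m G ] (xᵢ e * exactlyOnce (xᵢ e + c e))
    ≡⟨ cong₂ _+_ (unionSize≡∑atLeastOnce G (removeAt Ms i))
                 (sum-cong-≗ (λ e → cong ((xᵢ e *_) ∘ exactlyOnce) (multiplicity-removeAt Ms i e))) ⟨
  unionSize G (removeAt Ms i) + privateEdges G Ms i ∎
  where
  open ≤-Reasoning
  xᵢ : Fin (m G) → ℕ
  xᵢ e = iverson (Ms i e)
  c : Fin (m G) → ℕ
  c = multiplicity (removeAt Ms i)

iverson-incident : (G : Multigraph) (e : Fin (m G)) (v : Fin (n G)) →
  iverson (incident G e v) ≡ iverson ⌊ src G e ≟ v ⌋ + iverson ⌊ tgt G e ≟ v ⌋
iverson-incident G e v with src G e ≟ v | tgt G e ≟ v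
... | yes s≡v | yes t≡v = ⊥-elim (loopless G e (trans s≡v (sym t≡v)))
... | yes _   | no  _   = refl
... | no  _   | yes _   = refl
... | no  _   | no  _   = refl

∑-incident : (G : Multigraph) (e : Fin (m G)) → ∑[ v < n G ] iverson (incident G e v) ≡ 2
∑-incident G e = begin
  ∑[ v < n G ] iverson (incident G e v)
    ≡⟨ sum-cong-≗ (iverson-incident G e) ⟩
  ∑[ v < n G ] (iverson ⌊ src G e ≟ v ⌋ + iverson ⌊ tgt G e ≟ v ⌋)
    ≡⟨ ∑-distrib-+ (λ v → iverson ⌊ src G e ≟ v ⌋) (λ v → iverson ⌊ tgt G e ≟ v ⌋) ⟩
  ∑[ v < n G ] iverson ⌊ src G e ≟ v ⌋ + ∑[ v < n G ] iverson ⌊ tgt G e ≟ v ⌋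
    ≡⟨ cong₂ _+_ (∑-iverson-≟ (src G e)) (∑-iverson-≟ (tgt G e)) ⟩
  2 ∎
  where open ≡-Reasoning

handshake : (G : Multigraph) (w : Fin (m G) → ℕ) →
  ∑[ v < n G ] ∑[ e < m G ] (w e * iverson (incident G e v)) ≡ 2 * sum w
handshake G w = begin
  ∑[ v < n G ] ∑[ e < m G ] (w e * iverson (incident G e v))
    ≡⟨ ∑-comm (λ v e → w e * iverson (incident G e v)) ⟩
  ∑[ e < m G ] ∑[ v < n G ] (w e * iverson (incident G e v))
    ≡⟨ sum-cong-≗ (λ e → *-distribˡ-sum (w e) (iverson ∘ incident G e)) ⟨
  ∑[ e < m G ] (w e * ∑[ v < n G ] iverson (incident G e v))
    ≡⟨ sum-cong-≗ (λ e → cong (w e *_) (∑-incident G e)) ⟩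
  ∑[ e < m G ] (w e * 2)
    ≡⟨ *-distribʳ-sum 2 w ⟨
  sum w * 2
    ≡⟨ *-comm (sum w) 2 ⟩
  2 * sum w ∎
  where open ≡-Reasoning

degree≡∑incident : (G : Multigraph) (v : Fin (n G)) → degree G v ≡ ∑[ e < m G ] iverson (incident G e v)
degree≡∑incident G v = count≡∑iverson (λ e → incident G e v)

module _ (G : Multigraph) {t : ℕ} (Ms : Fin t → EdgeSet G)
         (matchings : ∀ l → PerfectMatching G (Ms l)) where

  ∑-multiplicity-at-vertex : ∀ v → ∑[ e < m G ] (iverson (incident G e v) * multiplicity Ms e) ≡ t
  ∑-multiplicity-at-vertex v = begin
    ∑[ e < m G ] (iverson (incident G e v) * multiplicity Ms e)
      ≡⟨ sum-cong-≗ (λ e → *-distribˡ-sum (iverson (incident G e v)) (λ l → iverson (Ms l e))) ⟩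
    ∑[ e < m G ] ∑[ l < t ] (iverson (incident G e v) * iverson (Ms l e))
      ≡⟨ ∑-comm (λ e l → iverson (incident G e v) * iverson (Ms l e)) ⟩
    ∑[ l < t ] ∑[ e < m G ] (iverson (incident G e v) * iverson (Ms l e))
      ≡⟨ sum-cong-≗ (λ l → trans (sum-cong-≗ (λ e → ∧-incident l e)) (sym (count≡∑iverson (λ e → Ms l e ∧ incident G e v)))) ⟩
    ∑[ l < t ] count (λ e → Ms l e ∧ incident G e v)
      ≡⟨ sum-cong-≗ (λ l → matchings l v) ⟩
    ∑[ l < t ] 1
      ≡⟨ trans (∑-const t 1) (*-identityʳ t) ⟩
    t ∎
    where
    open ≡-Reasoning
    ∧-incident : ∀ l e → iverson (incident G e v) * iverson (Ms l e) ≡ iverson (Ms l e ∧ incident G e v)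
    ∧-incident l e = trans (*-comm (iverson (incident G e v)) _) (sym (iverson-∧ (Ms l e) (incident G e v)))

  repeated-edge-at-vertex : Cubic G → 3 < t → ∀ v →
    0 < ∑[ e < m G ] (atLeastTwice (multiplicity Ms e) * iverson (incident G e v))
  repeated-edge-at-vertex cubic 3<t v
    with ∑[ e < m G ] (atLeastTwice (multiplicity Ms e) * iverson (incident G e v)) in none
  ... | suc _ = s≤s z≤n
  ... | zero  = ⊥-elim (<⇒≱ 3<t t≤3)
    where
    open ≤-Reasoning
    t≤3 : t ≤ 3
    t≤3 = begin
      t ≡⟨ ∑-multiplicity-at-vertex v ⟨
      ∑[ e < m G ] (iverson (incident G e v) * multiplicity Ms e)
        ≤⟨ sum-mono-≤ (λ e → atLeastTwice*≡0⇒*≤ (iverson (incident G e v)) (multiplicity Ms e)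
                               (sum≡0⇒≡0 _ none e)) ⟩
      ∑[ e < m G ] iverson (incident G e v) ≡⟨ degree≡∑incident G v ⟨
      degree G v ≡⟨ cubic v ⟩
      3 ∎

  edges≤3*repeatedEdges : Cubic G → 3 < t → m G ≤ 3 * repeatedEdges G Ms
  edges≤3*repeatedEdges cubic 3<t = *-cancelˡ-≤ 2 (begin
    2 * m G
      ≡⟨ cong (2 *_) (trans (∑-const (m G) 1) (*-identityʳ (m G))) ⟨
    2 * ∑[ _ < m G ] 1
      ≡⟨ handshake G (λ _ → 1) ⟨
    ∑[ v < n G ] ∑[ e < m G ] (1 * iverson (incident G e v))
      ≤⟨ sum-mono-≤ degree≤ ⟩
    ∑[ v < n G ] (3 * ∑[ e < m G ] (r e * iverson (incident G e v)))
      ≡⟨ *-distribˡ-sum 3 (λ v → ∑[ e < m G ] (r e * iverson (incident G e v))) ⟨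
    3 * ∑[ v < n G ] ∑[ e < m G ] (r e * iverson (incident G e v))
      ≡⟨ cong (3 *_) (handshake G r) ⟩
    3 * (2 * repeatedEdges G Ms)
      ≡⟨ trans (sym (*-assoc 3 2 (repeatedEdges G Ms))) (*-assoc 2 3 (repeatedEdges G Ms)) ⟩
    2 * (3 * repeatedEdges G Ms) ∎)
    where
    open ≤-Reasoning
    r : Fin (m G) → ℕ
    r = atLeastTwice ∘ multiplicity Ms
    degree≤ : ∀ v → ∑[ e < m G ] (1 * iverson (incident G e v))
                  ≤ 3 * ∑[ e < m G ] (r e * iverson (incident G e v))
    degree≤ v = begin
      ∑[ e < m G ] (1 * iverson (incident G e v)) ≡⟨ sum-cong-≗ (λ e → *-identityˡ (iverson (incident G e v))) ⟩
      ∑[ e < m G ] iverson (incident G e v)       ≡⟨ degree≡∑incident G v ⟨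
      degree G v                                  ≡⟨ cubic v ⟩
      3 * 1                                       ≤⟨ *-monoʳ-≤ 3 (repeated-edge-at-vertex cubic 3<t v) ⟩
      3 * ∑[ e < m G ] (r e * iverson (incident G e v)) ∎

deletion-inequality : ∀ j {u u′ a p r s : ℕ} →
  u ≤ u′ + a → suc j * a ≤ p → u ≡ p + r → s ≤ 3 * r →
  3 * j * u + s ≤ 3 * suc j * u′
deletion-inequality j {u′ = u′} {a} {p} {r} {s} u≤ a≤ refl s≤ = +-cancelʳ-≤ (3 * suc j * a) _ _ (begin
  3 * j * (p + r) + s + 3 * suc j * a
    ≤⟨ +-mono-≤ (+-monoʳ-≤ (3 * j * (p + r)) s≤) (≤-trans (≤-reflexive (*-assoc 3 (suc j) a)) (*-monoʳ-≤ 3 a≤)) ⟩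
  3 * j * (p + r) + 3 * r + 3 * p
    ≡⟨ solve (j ∷ p ∷ r ∷ []) ⟩
  3 * suc j * (p + r)
    ≤⟨ *-monoʳ-≤ (3 * suc j) u≤ ⟩
  3 * suc j * (u′ + a)
    ≡⟨ *-distribˡ-+ (3 * suc j) u′ a ⟩
  3 * suc j * u′ + 3 * suc j * a ∎)
  where open ≤-Reasoning

theorem11 : (G : Multigraph) → Cubic G → Bridgeless G →
    (j : ℕ) → 3 ≤ j →
    (Ms : Fin (suc j) → EdgeSet G) → (∀ i → PerfectMatching G (Ms i)) →
    Σ (Fin j → EdgeSet G) λ Ns → (∀ i → PerfectMatching G (Ns i)) ×
    (3 * j * unionSize G Ms + m G ≤ 3 * suc j * unionSize G Ns)
theorem11 G cubic _ j 3≤j Ms matchings with ∃-below-average (privateEdges G Ms)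
... | i , fewestPrivate =
  removeAt Ms i , matchings ∘ punchIn i ,
  deletion-inequality j
    (unionSize-removeAt G Ms i)
    fewestPrivate
    (unionSize≡private+repeated G Ms)
    (edges≤3*repeatedEdges G Ms matchings cubic (s≤s 3≤j))
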